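{- For integers $k \geq 0$ and $r \geq (k+1)(k+2)$, the graph $K_r \vee E_{k+2}$ is $d_k$-choosable.
   Context: $K_r$ is the complete graph on $r$ vertices and $E_m$ the edgeless graph on $m$ vertices. $A \vee B$ is the join (disjoint union plus all edges between $V(A)$ and $V(B)$). A graph $G$ is $d_k$-choosable if for every assignment of lists $L(v)$ of colors with $|L(v)| = d_G(v) - k$ there is a proper coloring $c$ with $c(v) \in L(v)$ for all $v$. -}

module Defs where

open import Data.Nat using (ℕ; _∸_; _+_)
open import Data.Fin using (Fin; splitAt)
open import Data.Fin.Properties using (_≟_)
open import Data.Sum using (_⊎_; inj₁; inj₂)
open import Data.Bool using (Bool; true; false; not)
open import Data.List using (List; length; filterᵇ)
open import Data.List.Membership.Propositional using (_∈_)
open import Data.List.Relation.Unary.Unique.Propositional using (Unique)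
open import Data.List using (allFin)
open import Relation.Binary.PropositionalEquality using (_≡_)
open import Relation.Nullary.Decidable using (⌊_⌋)
open import Relation.Nullary using (yes; no)
open import Data.Product using (Σ; _×_)
open import Data.Empty using (⊥; ⊥-elim)
open import Relation.Binary.PropositionalEquality using (refl; sym)

record Graph (n : ℕ) : Set where
  field
    adj       : Fin n → Fin n → Bool
    adj-sym   : ∀ u v → adj u v ≡ adj v u
    adj-irr   : ∀ v → adj v v ≡ false

open Graph public

degree : ∀ {n} → Graph n → Fin n → ℕ
degree G v = length (filterᵇ (adj G v) (allFin _))

IsDkAssignment : ∀ {n} → ℕ → Graph n → (Fin n → List ℕ) → Set
IsDkAssignment {n} k G L =
  (v : Fin n) → Unique (L v) × length (L v) ≡ degree G v ∸ k

IsProperLColouring : ∀ {n} → Graph n → (Fin n → List ℕ) → (Fin n → ℕ) → Set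
IsProperLColouring {n} G L c =
  ((v : Fin n) → c v ∈ L v) ×
  ((u v : Fin n) → adj G u v ≡ true → c u ≡ c v → ⊥)

DkChoosable : ∀ {n} → ℕ → Graph n → Set
DkChoosable {n} k G =
  (L : Fin n → List ℕ) → IsDkAssignment k G L →
  Σ (Fin n → ℕ) (IsProperLColouring G L)

-- K_r ∨ E_m on vertex set Fin (r + m): the first r vertices form the
-- clique K_r, the last m the independent set E_m.
joinAdj : ∀ r m → Fin (r + m) → Fin (r + m) → Bool
joinAdj r m u v with splitAt r u | splitAt r v
... | inj₁ i | inj₁ j = not ⌊ i ≟ j ⌋
... | inj₁ _ | inj₂ _ = true
... | inj₂ _ | inj₁ _ = true
... | inj₂ _ | inj₂ _ = false

joinAdj-sym : ∀ r m u v → joinAdj r m u v ≡ joinAdj r m v u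
joinAdj-sym r m u v with splitAt r u | splitAt r v
... | inj₁ i | inj₁ j with i ≟ j | j ≟ i
...   | yes _ | yes _ = _≡_.refl
...   | no _  | no _  = _≡_.refl
...   | yes p | no q  = ⊥-elim (q (sym p))
...   | no q  | yes p = ⊥-elim (q (sym p))
joinAdj-sym r m u v | inj₁ _ | inj₂ _ = _≡_.refl
joinAdj-sym r m u v | inj₂ _ | inj₁ _ = _≡_.refl
joinAdj-sym r m u v | inj₂ _ | inj₂ _ = _≡_.refl

joinAdj-irr : ∀ r m v → joinAdj r m v v ≡ false
joinAdj-irr r m v with splitAt r v
... | inj₁ i with i ≟ i
...   | yes _ = _≡_.refl
...   | no q = ⊥-elim (q _≡_.refl)
joinAdj-irr r m v | inj₂ _ = _≡_.refl

KJoinE : (r m : ℕ) → Graph (r + m)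
KJoinE r m = record
  { adj = joinAdj r m
  ; adj-sym = joinAdj-sym r m
  ; adj-irr = joinAdj-irr r m
  }

-- In K_r ∨ E_(k+2) a clique vertex has degree r + k + 1 and an independent vertex degree r,
-- so the clique lists have r + 1 colours and the independent lists r - k.  Each independent
-- list thus falls short of r + 1 by at most k + 1, a total shortfall of at most
-- (k + 1)(k + 2) ≤ r.  Colour the clique one vertex at a time, keeping the invariant that,
-- with n clique vertices left, their lists have at least n + 1 colours and the independent
-- lists fall short of n + 1 by at most n in total.  Take a colour c from the first clique
-- list.  If some independent list of length ≤ n misses c, give c to that clique vertex and
-- delete c from all lists: the shortfall drops by one, as does n.  Otherwise c lies in
-- every short independent list: reserve c for those vertices, colour the clique greedily
-- from its lists without c, and give each remaining independent vertex, whose list has more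
-- than n colours, a colour unused on the clique.
module Submission where

open import Defs
open import Data.Nat.Base using (ℕ; zero; suc; _+_; _*_; _∸_; _≤_; _<_; z≤n; s≤s; s≤s⁻¹)
open import Data.Nat.Properties
  using ( ≤-trans; ≤-reflexive; +-mono-≤; +-mono-≤-<; m≤m+n; m≤n+m; n≤1+n; ≰⇒>; <⇒≱; _≤?_
        ; n≤0⇒n≡0; m∸n≡0⇒m≤n; ∸-monoʳ-≤; +-∸-assoc; m+n∸m≡n; m≤n+o⇒m∸n≤o; m≤n+m∸n
        ; suc-injective; +-comm; +-assoc; *-comm; *-identityʳ; *-zeroʳ; +-identityʳ
        ; +-0-commutativeMonoid; module ≤-Reasoning )
  renaming (_≟_ to _≟ℕ_)
open import Data.Fin using (Fin; zero; suc; _↑ˡ_; _↑ʳ_; splitAt; punchIn; fromℕ<)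
import Data.Fin.Properties as Fin
open import Data.Bool using (Bool; true; false; if_then_else_)
open import Data.List using (List; _∷_; length; lookup; filter; filterᵇ; tabulate)
open import Data.List.Properties using (length-tabulate)
open import Data.List.Membership.Propositional using (_∈_; _∉_; find)
open import Data.List.Membership.Propositional.Properties using (∈-lookup; ∈-tabulate⁺; ∈-filter⁺; ∈-filter⁻)
open import Data.List.Membership.Setoid.Properties using (index-injective)
open import Data.List.Relation.Binary.Subset.Propositional using (_⊆_)
open import Data.List.Relation.Unary.Any as Any using (here; there)
open import Data.List.Relation.Unary.All as All using (all?)
open import Data.List.Relation.Unary.All.Properties using (¬All⇒Any¬)
open import Data.List.Relation.Unary.AllPairs using (_∷_)
open import Data.List.Relation.Unary.Unique.Propositional using (Unique)
import Data.List.Relation.Unary.Unique.Propositional.Properties as Unique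
import Data.Vec.Functional as Vector
open import Data.Sum using (inj₁; inj₂; [_,_]′)
open import Data.Product using (Σ; _×_; _,_; proj₁; proj₂; ∃-syntax)
open import Data.Empty using (⊥; ⊥-elim)
open import Function using (_∘_; Injective; case_of_)
open import Relation.Nullary using (yes; no; contradiction)
open import Relation.Nullary.Decidable using (_×-dec_; ¬?; decidable-stable)
open import Relation.Binary using (DecidableEquality)
open import Relation.Binary.PropositionalEquality
  using (_≡_; _≢_; refl; sym; trans; cong; cong₂; subst; setoid; module ≡-Reasoning)
open import Algebra.Properties.CommutativeMonoid.Sum +-0-commutativeMonoid
  using (sum; sum-syntax; sum-cong-≗; sum-remove)
open import Data.Nat.Tactic.RingSolver using (solve-∀)

∑-mono-≤ : ∀ {n} {f g : Fin n → ℕ} → (∀ i → f i ≤ g i) → sum f ≤ sum g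
∑-mono-≤ {zero}  f≤g = z≤n
∑-mono-≤ {suc n} f≤g = +-mono-≤ (f≤g zero) (∑-mono-≤ (f≤g ∘ suc))

∑-mono-< : ∀ {n} {f g : Fin n → ℕ} → (∀ i → f i ≤ g i) → ∀ i → f i < g i → sum f < sum g
∑-mono-< f≤g zero    fi<gi = +-mono-≤ fi<gi (∑-mono-≤ (f≤g ∘ suc))
∑-mono-< f≤g (suc i) fi<gi = +-mono-≤-< (f≤g zero) (∑-mono-< (f≤g ∘ suc) i fi<gi)

≤-∑ : ∀ {n} (f : Fin n → ℕ) i → f i ≤ sum f
≤-∑ f zero    = m≤m+n _ _
≤-∑ f (suc i) = ≤-trans (≤-∑ (f ∘ suc) i) (m≤n+m _ _)

∑-const : ∀ n c → ∑[ i < n ] c ≡ n * c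
∑-const zero    c = refl
∑-const (suc n) c = cong (c +_) (∑-const n c)

∑-↑ : ∀ a {b} (g : Fin (a + b) → ℕ) → sum g ≡ ∑[ i < a ] g (i ↑ˡ b) + ∑[ j < b ] g (a ↑ʳ j)
∑-↑ zero    g = refl
∑-↑ (suc a) g = trans (cong (g zero +_) (∑-↑ a (g ∘ suc))) (sym (+-assoc (g zero) _ _))

module _ {A : Set} where

  Unique⇒lookup-injective : {xs : List A} → Unique xs → Injective _≡_ _≡_ (lookup xs)
  Unique⇒lookup-injective {x ∷ xs} (x≢xs ∷ u) {zero}  {zero}  _ = refl
  Unique⇒lookup-injective {x ∷ xs} (x≢xs ∷ u) {zero}  {suc j} e = ⊥-elim (All.lookup x≢xs (∈-lookup j) e)
  Unique⇒lookup-injective {x ∷ xs} (x≢xs ∷ u) {suc i} {zero}  e = ⊥-elim (All.lookup x≢xs (∈-lookup i) (sym e))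
  Unique⇒lookup-injective {x ∷ xs} (x≢xs ∷ u) {suc i} {suc j} e = cong suc (Unique⇒lookup-injective u e)

  Unique-⊆⇒length≤ : {xs ys : List A} → Unique xs → xs ⊆ ys → length xs ≤ length ys
  Unique-⊆⇒length≤ {xs} {ys} u xs⊆ys = Fin.injective⇒≤ position-injective
    where
    position : Fin (length xs) → Fin (length ys)
    position i = Any.index (xs⊆ys (∈-lookup i))

    position-injective : Injective _≡_ _≡_ position
    position-injective eq = Unique⇒lookup-injective u (index-injective (setoid A) _ _ eq)

  ∷-injective : ∀ {n} {x : A} {g : Fin n → A} →
                (∀ i → g i ≢ x) → Injective _≡_ _≡_ g → Injective _≡_ _≡_ (x Vector.∷ g)
  ∷-injective x∉g g-inj {zero}  {zero}  _ = refl
  ∷-injective x∉g g-inj {zero}  {suc j} e = ⊥-elim (x∉g j (sym e))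
  ∷-injective x∉g g-inj {suc i} {zero}  e = ⊥-elim (x∉g i e)
  ∷-injective x∉g g-inj {suc i} {suc j} e = cong suc (g-inj e)

  record InjectiveChoice {n} (L : Fin n → List A) : Set where
    field
      choice           : Fin n → A
      choice-∈         : ∀ i → choice i ∈ L i
      choice-injective : Injective _≡_ _≡_ choice

  record JoinColouring {n m} (L : Fin n → List A) (M : Fin m → List A) : Set where
    field
      clique             : Fin n → A
      clique-∈           : ∀ i → clique i ∈ L i
      clique-injective   : Injective _≡_ _≡_ clique
      independent        : Fin m → A
      independent-∈      : ∀ j → independent j ∈ M j
      clique≢independent : ∀ i j → clique i ≢ independent j

  shortfall : ∀ {m} → ℕ → (Fin m → List A) → ℕ
  shortfall {m} n M = ∑[ j < m ] (n ∸ length (M j))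

module _ {A : Set} (_≟_ : DecidableEquality A) where

  open import Data.List.Membership.DecPropositional _≟_ using (_∈?_)

  ∃∉image : ∀ {n} {xs : List A} → Unique xs → n < length xs →
            (f : Fin n → A) → ∃[ x ] x ∈ xs × (∀ i → f i ≢ x)
  ∃∉image {n} {xs} u n<∣xs∣ f with all? (λ x → Fin.any? (λ i → f i ≟ x)) xs
  ... | yes covered = contradiction (Unique-⊆⇒length≤ u xs⊆image)
                                    (<⇒≱ (subst (_< length xs) (sym (length-tabulate f)) n<∣xs∣))
    where
    xs⊆image : xs ⊆ tabulate f
    xs⊆image x∈xs with i , fi≡x ← All.lookup covered x∈xs = subst (_∈ tabulate f) fi≡x (∈-tabulate⁺ i)
  ... | no ¬covered with x , x∈xs , ¬hit ← find (¬All⇒Any¬ (λ x → Fin.any? (λ i → f i ≟ x)) xs ¬covered)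
    = x , x∈xs , λ i fi≡x → ¬hit (i , fi≡x)

  remove : A → List A → List A
  remove c = filter (λ x → ¬? (x ≟ c))

  ∈-remove⁻ : ∀ {c x} xs → x ∈ remove c xs → x ∈ xs × x ≢ c
  ∈-remove⁻ _ = ∈-filter⁻ (λ x → ¬? (x ≟ _))

  Unique-remove : ∀ {c xs} → Unique xs → Unique (remove c xs)
  Unique-remove = Unique.filter⁺ (λ x → ¬? (x ≟ _))

  length-remove : ∀ {c xs} → Unique xs → length xs ≤ suc (length (remove c xs))
  length-remove {c} {xs} u = Unique-⊆⇒length≤ u xs⊆c∷rest
    where
    xs⊆c∷rest : xs ⊆ c ∷ remove c xs
    xs⊆c∷rest {x} x∈xs with x ≟ c
    ... | yes refl = here refl
    ... | no x≢c   = there (∈-filter⁺ (λ x → ¬? (x ≟ c)) x∈xs x≢c)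

  length-remove-∉ : ∀ {c xs} → Unique xs → c ∉ xs → length xs ≤ length (remove c xs)
  length-remove-∉ {c} u c∉xs =
    Unique-⊆⇒length≤ u (λ x∈xs → ∈-filter⁺ (λ x → ¬? (x ≟ c)) x∈xs λ { refl → c∉xs x∈xs })

  shortfall-remove : ∀ {n m} (M : Fin m → List A) c → (∀ j → Unique (M j)) →
                     ∀ j₀ → length (M j₀) ≤ n → c ∉ M j₀ →
                     shortfall n (remove c ∘ M) < shortfall (suc n) M
  shortfall-remove {n} M c u j₀ short c∉ = ∑-mono-< never-grows j₀ drops
    where
    never-grows : ∀ j → n ∸ length (remove c (M j)) ≤ suc n ∸ length (M j)
    never-grows j = ∸-monoʳ-≤ (suc n) (length-remove (u j))

    drops : n ∸ length (remove c (M j₀)) < suc n ∸ length (M j₀)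
    drops = ≤-trans (s≤s (∸-monoʳ-≤ n (length-remove-∉ (u j₀) c∉)))
                    (≤-reflexive (sym (+-∸-assoc 1 short)))

  injectiveChoice : ∀ {n} (L : Fin n → List A) → (∀ i → Unique (L i)) → (∀ i → n ≤ length (L i)) →
                    InjectiveChoice L
  injectiveChoice {zero}  L u len = record { choice = λ () ; choice-∈ = λ () ; choice-injective = λ { {()} } }
  injectiveChoice {suc n} L u len =
    let x , x∈L₀ , x∉choice = ∃∉image (u zero) (len zero) choice in record
    { choice           = x Vector.∷ choice
    ; choice-∈         = λ { zero → x∈L₀ ; (suc i) → choice-∈ i }
    ; choice-injective = ∷-injective x∉choice choice-injective
    }
    where
    open InjectiveChoice (injectiveChoice (L ∘ suc) (u ∘ suc) (λ i → ≤-trans (n≤1+n n) (len (suc i))))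

  extendClique : ∀ {n m} {L : Fin (suc n) → List A} {M : Fin m → List A} {c} → c ∈ L zero →
                 JoinColouring (remove c ∘ L ∘ suc) (remove c ∘ M) → JoinColouring L M
  extendClique {L = L} {M} {c} c∈L₀ χ = record
    { clique             = c Vector.∷ clique
    ; clique-∈           = λ { zero → c∈L₀ ; (suc i) → proj₁ (∈-remove⁻ (L (suc i)) (clique-∈ i)) }
    ; clique-injective   = ∷-injective (λ i → proj₂ (∈-remove⁻ (L (suc i)) (clique-∈ i))) clique-injective
    ; independent        = independent
    ; independent-∈      = λ j → proj₁ (∈-remove⁻ (M j) (independent-∈ j))
    ; clique≢independent = λ where
        zero    j c≡ → proj₂ (∈-remove⁻ (M j) (independent-∈ j)) (sym c≡)
        (suc i) j    → clique≢independent i j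
    }
    where open JoinColouring χ

  reserveColour : ∀ {n m} (L : Fin n → List A) (M : Fin m → List A) c →
                  (∀ i → Unique (L i)) → (∀ j → Unique (M j)) → (∀ i → suc n ≤ length (L i)) →
                  (∀ j → length (M j) ≤ n → c ∈ M j) → JoinColouring L M
  reserveColour {n} L M c uL uM lenL c∈short = record
    { clique             = choice
    ; clique-∈           = λ i → proj₁ (∈-remove⁻ (L i) (choice-∈ i))
    ; clique-injective   = choice-injective
    ; independent        = λ j → proj₁ (pick j)
    ; independent-∈      = λ j → proj₁ (proj₂ (pick j))
    ; clique≢independent = λ i j → proj₂ (proj₂ (pick j)) i
    }
    where
    open InjectiveChoice (injectiveChoice (remove c ∘ L) (Unique-remove ∘ uL)
                                          (λ i → s≤s⁻¹ (≤-trans (lenL i) (length-remove (uL i)))))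
    pick : ∀ j → ∃[ y ] y ∈ M j × (∀ i → choice i ≢ y)
    pick j with length (M j) ≤? n
    ... | yes short = c , c∈short j short , λ i → proj₂ (∈-remove⁻ (L i) (choice-∈ i))
    ... | no long   = ∃∉image (uM j) (≰⇒> long) choice

  joinColouring : ∀ n {m} (L : Fin n → List A) (M : Fin m → List A) →
                  (∀ i → Unique (L i)) → (∀ j → Unique (M j)) → (∀ i → suc n ≤ length (L i)) →
                  shortfall (suc n) M ≤ n → JoinColouring L M
  joinColouring zero L M uL uM lenL short = record
    { clique             = λ ()
    ; clique-∈           = λ ()
    ; clique-injective   = λ { {()} }
    ; independent        = λ j → lookup (M j) (fromℕ< (nonEmpty j))
    ; independent-∈      = λ j → ∈-lookup (fromℕ< (nonEmpty j))
    ; clique≢independent = λ ()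
    }
    where
    nonEmpty : ∀ j → 0 < length (M j)
    nonEmpty j = m∸n≡0⇒m≤n (n≤0⇒n≡0 (≤-trans (≤-∑ (λ j → 1 ∸ length (M j)) j) short))
  joinColouring (suc n) L M uL uM lenL short =
    case Fin.any? (λ j → (length (M j) ≤? suc n) ×-dec ¬? (c ∈? M j)) of λ where
      (yes (j₀ , short₀ , c∉)) → extendClique (∈-lookup _) (joinColouring n _ _
        (Unique-remove ∘ uL ∘ suc) (Unique-remove ∘ uM)
        (λ i → s≤s⁻¹ (≤-trans (lenL (suc i)) (length-remove (uL (suc i)))))
        (s≤s⁻¹ (≤-trans (shortfall-remove M c uM j₀ short₀ c∉) short)))
      (no ¬short) → reserveColour L M c uL uM lenL
        (λ j short₀ → decidable-stable (c ∈? M j) (λ c∉ → ¬short (j , short₀ , c∉)))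
    where
    c : A
    c = lookup (L zero) (fromℕ< (lenL zero))

indicator : Bool → ℕ
indicator b = if b then 1 else 0

∑-indicator-true : ∀ {n} {b : Fin n → Bool} → (∀ i → b i ≡ true) → ∑[ i < n ] indicator (b i) ≡ n
∑-indicator-true {n} bᵢ≡true =
  trans (sum-cong-≗ (cong indicator ∘ bᵢ≡true)) (trans (∑-const n 1) (*-identityʳ n))

∑-indicator-false : ∀ {n} {b : Fin n → Bool} → (∀ i → b i ≡ false) → ∑[ i < n ] indicator (b i) ≡ 0
∑-indicator-false {n} bᵢ≡false =
  trans (sum-cong-≗ (cong indicator ∘ bᵢ≡false)) (trans (∑-const n 0) (*-zeroʳ n))

length-filterᵇ-tabulate : ∀ {B : Set} {n} (p : B → Bool) (f : Fin n → B) →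
                          length (filterᵇ p (tabulate f)) ≡ ∑[ i < n ] indicator (p (f i))
length-filterᵇ-tabulate {n = zero}  p f = refl
length-filterᵇ-tabulate {n = suc n} p f with p (f zero)
... | true  = cong suc (length-filterᵇ-tabulate p (f ∘ suc))
... | false = length-filterᵇ-tabulate p (f ∘ suc)

degree≡∑ : ∀ {n} (G : Graph n) v → degree G v ≡ ∑[ u < n ] indicator (adj G v u)
degree≡∑ G v = length-filterᵇ-tabulate (adj G v) (λ u → u)

adj-↑ˡ-↑ˡ : ∀ r m {i j : Fin r} → i ≢ j → joinAdj r m (i ↑ˡ m) (j ↑ˡ m) ≡ true
adj-↑ˡ-↑ˡ r m {i} {j} i≢j rewrite Fin.splitAt-↑ˡ r i m | Fin.splitAt-↑ˡ r j m with i Fin.≟ j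
... | yes i≡j = contradiction i≡j i≢j
... | no _    = refl

adj-↑ˡ-↑ʳ : ∀ r m i j → joinAdj r m (i ↑ˡ m) (r ↑ʳ j) ≡ true
adj-↑ˡ-↑ʳ r m i j rewrite Fin.splitAt-↑ˡ r i m | Fin.splitAt-↑ʳ r m j = refl

adj-↑ʳ-↑ʳ : ∀ r m i j → joinAdj r m (r ↑ʳ i) (r ↑ʳ j) ≡ false
adj-↑ʳ-↑ʳ r m i j rewrite Fin.splitAt-↑ʳ r m i | Fin.splitAt-↑ʳ r m j = refl

degree-clique : ∀ r m (i : Fin r) → suc (degree (KJoinE r m) (i ↑ˡ m)) ≡ r + m
degree-clique (suc n) m i = cong suc (begin
  degree (KJoinE (suc n) m) (i ↑ˡ m)                 ≡⟨ degree≡∑ (KJoinE (suc n) m) (i ↑ˡ m) ⟩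
  sum row                                            ≡⟨ ∑-↑ (suc n) row ⟩
  sum (row ∘ (_↑ˡ m)) + ∑[ j < m ] row (suc n ↑ʳ j)  ≡⟨ cong₂ _+_ clique-part independent-part ⟩
  n + m                                              ∎)
  where
  open ≡-Reasoning
  row : Fin (suc n + m) → ℕ
  row u = indicator (joinAdj (suc n) m (i ↑ˡ m) u)

  clique-part : sum (row ∘ (_↑ˡ m)) ≡ n
  clique-part = begin
    sum (row ∘ (_↑ˡ m))                               ≡⟨ sum-remove {i = i} (row ∘ (_↑ˡ m)) ⟩
    row (i ↑ˡ m) + ∑[ j < n ] row (punchIn i j ↑ˡ m)  ≡⟨ cong₂ _+_ (cong indicator (joinAdj-irr (suc n) m (i ↑ˡ m)))
                                                                   (∑-indicator-true (λ j → adj-↑ˡ-↑ˡ (suc n) m (Fin.punchInᵢ≢i i j ∘ sym))) ⟩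
    0 + n                                             ∎

  independent-part : ∑[ j < m ] row (suc n ↑ʳ j) ≡ m
  independent-part = ∑-indicator-true (adj-↑ˡ-↑ʳ (suc n) m i)

degree-independent : ∀ r m j → degree (KJoinE r m) (r ↑ʳ j) ≡ r
degree-independent r m j = begin
  degree (KJoinE r m) (r ↑ʳ j)                           ≡⟨ degree≡∑ (KJoinE r m) (r ↑ʳ j) ⟩
  sum row                                                ≡⟨ ∑-↑ r row ⟩
  ∑[ i < r ] row (i ↑ˡ m) + ∑[ i < m ] row (r ↑ʳ i)      ≡⟨ cong₂ _+_ (∑-indicator-true clique-adjacent) (∑-indicator-false (adj-↑ʳ-↑ʳ r m j)) ⟩
  r + 0                                                  ≡⟨ +-identityʳ r ⟩
  r                                                      ∎
  where
  open ≡-Reasoning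
  row : Fin (r + m) → ℕ
  row u = indicator (joinAdj r m (r ↑ʳ j) u)
  clique-adjacent : ∀ i → joinAdj r m (r ↑ʳ j) (i ↑ˡ m) ≡ true
  clique-adjacent i = trans (joinAdj-sym r m _ _) (adj-↑ˡ-↑ʳ r m i j)

data JoinVertex r m : Fin (r + m) → Set where
  clique-vertex      : (i : Fin r) → JoinVertex r m (i ↑ˡ m)
  independent-vertex : (j : Fin m) → JoinVertex r m (r ↑ʳ j)

joinVertex : ∀ r m u → JoinVertex r m u
joinVertex r m u with splitAt r u in eq
... | inj₁ i = subst (JoinVertex r m) (Fin.splitAt⁻¹-↑ˡ eq) (clique-vertex i)
... | inj₂ j = subst (JoinVertex r m) (Fin.splitAt⁻¹-↑ʳ eq) (independent-vertex j)

joinColouring⇒proper : ∀ {r m} (L : Fin (r + m) → List ℕ) →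
                       JoinColouring (L ∘ (_↑ˡ m)) (L ∘ (r ↑ʳ_)) →
                       Σ (Fin (r + m) → ℕ) (IsProperLColouring (KJoinE r m) L)
joinColouring⇒proper {r} {m} L χ = colour , colour-∈ , colour-proper
  where
  open JoinColouring χ

  colour : Fin (r + m) → ℕ
  colour = [ clique , independent ]′ ∘ splitAt r

  colour-↑ˡ : ∀ i → colour (i ↑ˡ m) ≡ clique i
  colour-↑ˡ i = cong [ clique , independent ]′ (Fin.splitAt-↑ˡ r i m)

  colour-↑ʳ : ∀ j → colour (r ↑ʳ j) ≡ independent j
  colour-↑ʳ j = cong [ clique , independent ]′ (Fin.splitAt-↑ʳ r m j)

  colour-∈ : ∀ u → colour u ∈ L u
  colour-∈ u with joinVertex r m u
  ... | clique-vertex i      = subst (_∈ L (i ↑ˡ m)) (sym (colour-↑ˡ i)) (clique-∈ i)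
  ... | independent-vertex j = subst (_∈ L (r ↑ʳ j)) (sym (colour-↑ʳ j)) (independent-∈ j)

  colour-proper : ∀ u v → joinAdj r m u v ≡ true → colour u ≡ colour v → ⊥
  colour-proper u v with joinVertex r m u | joinVertex r m v
  ... | clique-vertex i | clique-vertex j = λ adjacent same →
    case clique-injective (trans (sym (colour-↑ˡ i)) (trans same (colour-↑ˡ j))) of λ where
      refl → case trans (sym adjacent) (joinAdj-irr r m (i ↑ˡ m)) of λ ()
  ... | clique-vertex i | independent-vertex j = λ _ same →
    clique≢independent i j (trans (sym (colour-↑ˡ i)) (trans same (colour-↑ʳ j)))
  ... | independent-vertex j | clique-vertex i = λ _ same →
    clique≢independent i j (trans (sym (colour-↑ˡ i)) (trans (sym same) (colour-↑ʳ j)))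
  ... | independent-vertex i | independent-vertex j = λ adjacent _ →
    case trans (sym adjacent) (adj-↑ʳ-↑ʳ r m i j) of λ ()

suc[m]∸[m∸n]≤suc[n] : ∀ m n → suc m ∸ (m ∸ n) ≤ suc n
suc[m]∸[m∸n]≤suc[n] m n = m≤n+o⇒m∸n≤o (suc m) (m ∸ n)
  (≤-trans (s≤s (m≤n+m∸n m n)) (≤-reflexive (+-comm (suc n) (m ∸ n))))

module _ {k r} {L : Fin (r + (k + 2)) → List ℕ} (dk : IsDkAssignment k (KJoinE r (k + 2)) L) where

  length-clique-list : ∀ i → length (L (i ↑ˡ (k + 2))) ≡ suc r
  length-clique-list i = begin
    length (L (i ↑ˡ (k + 2)))                     ≡⟨ proj₂ (dk (i ↑ˡ (k + 2))) ⟩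
    degree (KJoinE r (k + 2)) (i ↑ˡ (k + 2)) ∸ k  ≡⟨ cong (_∸ k) clique-degree ⟩
    k + suc r ∸ k                                 ≡⟨ m+n∸m≡n k (suc r) ⟩
    suc r                                         ∎
    where
    open ≡-Reasoning
    rearrange : ∀ a b → a + (b + 2) ≡ suc (b + suc a)
    rearrange = solve-∀
    clique-degree : degree (KJoinE r (k + 2)) (i ↑ˡ (k + 2)) ≡ k + suc r
    clique-degree = suc-injective (trans (degree-clique r (k + 2) i) (rearrange r k))

  length-independent-list : ∀ j → length (L (r ↑ʳ j)) ≡ r ∸ k
  length-independent-list j = trans (proj₂ (dk (r ↑ʳ j))) (cong (_∸ k) (degree-independent r (k + 2) j))

mainTheorem16 : (k r : ℕ) → (k + 1) * (k + 2) ≤ r → DkChoosable k (KJoinE r (k + 2))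
mainTheorem16 k r h L dk = joinColouring⇒proper L
  (joinColouring _≟ℕ_ r (L ∘ (_↑ˡ m)) (L ∘ (r ↑ʳ_)) (proj₁ ∘ dk ∘ (_↑ˡ m)) (proj₁ ∘ dk ∘ (r ↑ʳ_))
     (≤-reflexive ∘ sym ∘ length-clique-list dk) shortfall≤r)
  where
  open ≤-Reasoning
  m : ℕ
  m = k + 2

  independent-shortfall : ∀ j → suc r ∸ length (L (r ↑ʳ j)) ≤ suc k
  independent-shortfall j =
    subst (λ ℓ → suc r ∸ ℓ ≤ suc k) (sym (length-independent-list dk j)) (suc[m]∸[m∸n]≤suc[n] r k)

  shortfall≤r : shortfall (suc r) (L ∘ (r ↑ʳ_)) ≤ r
  shortfall≤r = begin
    shortfall (suc r) (L ∘ (r ↑ʳ_))  ≤⟨ ∑-mono-≤ independent-shortfall ⟩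
    ∑[ j < m ] suc k                 ≡⟨ ∑-const m (suc k) ⟩
    m * suc k                        ≡⟨ trans (*-comm m (suc k)) (cong (_* m) (+-comm 1 k)) ⟩
    (k + 1) * m                      ≤⟨ h ⟩
    r                                ∎
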